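{- Let $r,n\ge1$ and $\mathbf f=(f_1,\dots,f_n)$ with $1\le f_1\le\cdots\le f_n\le n$ such that $\mathsf{G}_{r,n,\mathbf f}\ne\emptyset$, and $H(\mathbf f)=(h_1,\dots,h_n)$. In $\mathbb{Z}[\mathsf{G}_{r,n}]$ let $\Psi_1=1+\sum_{t=1}^{r-1}(1^{[t]}\,1)$ and for $2\le j\le n$, $\Psi_j=1+\sum_{i=h_j}^{j-1}(i\,j)+\sum_{t=1}^{r-1}\sum_{i=h_j}^{j}(i^{[t]}\,j)$. Then $\Psi_1\Psi_2\cdots\Psi_n=\sum_{\pi\in\mathsf{G}_{r,n,\mathbf f}}\pi$.
   Context: $\Sigma=\{i^{[c]}:1\le i\le n,\ c\in\mathbb{Z}/r\mathbb{Z}\}$. $\mathsf{G}_{r,n}$: group under composition of bijections $\pi$ of $\Sigma$ with $\pi(i^{[c]})=\sigma_i^{[z_i+c]}$, $\sigma\in\mathfrak S_n$; window $\pi=\sigma_1^{[z_1]}\cdots\sigma_n^{[z_n]}$. $\mathsf{G}_{r,n,\mathbf f}=\{\pi:\sigma_i\le f_i\ \forall i\}$. $h_j$ is the smallest index $i$ such that some $\pi\in\mathsf{G}_{r,n,\mathbf f}$ has $\sigma_i=j$. For $1\le i<j\le n$, $0\le t<r$: $(i^{[t]}\,j)$ is the element whose window has $j^{[-t]}$ in position $i$, $i^{[t]}$ in position $j$, $k$ in each other position $k$; $(i\,j)=(i^{[0]}\,j)$. For $0<t<r$: $(i^{[t]}\,i)$ is the element whose window has $i^{[t]}$ in position $i$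 and $k$ in each other position $k$. -}

module Defs where

open import Data.Nat as ℕ using (ℕ; zero; suc; _∸_; NonZero; _≤_)
open import Data.Nat.DivMod using (_mod_)
open import Data.Fin as Fin using (Fin; toℕ)
open import Data.Fin.Properties as FinP using ()
open import Data.Integer as ℤ using (ℤ; 0ℤ; 1ℤ)
open import Data.Product using (Σ; _×_; _,_; proj₁; proj₂)
open import Data.Product.Properties using (≡-dec)
open import Data.Vec as Vec using (Vec; lookup; tabulate)
import Data.Vec.Properties as VecP
open import Data.List as List using (List; []; _∷_; _++_; map; concatMap; filter; foldr; allFin)
open import Relation.Nullary using (Dec; yes; no; ¬_)
open import Relation.Nullary.Decidable using (⌊_⌋)
open import Relation.Binary.PropositionalEquality using (_≡_)
open import Data.Bool using (if_then_else_)

-- The wreath product G_{r,n} = Z/rZ ≀ S_n, with 0-based indices: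
-- positions and values are in Fin n (paper's i corresponds to Fin index i-1),
-- colours are in Fin r, read as Z/rZ.
module Wreath (r n : ℕ) .{{_ : NonZero r}} where

  Colour : Set
  Colour = Fin r

  _⊕_ : Colour → Colour → Colour
  c ⊕ d = (toℕ c ℕ.+ toℕ d) mod r

  ⊖_ : Colour → Colour
  ⊖ c = (r ∸ toℕ c) mod r

  c0 : Colour
  c0 = 0 mod r

  -- A window σ_1^{[z_1]} ⋯ σ_n^{[z_n]}: entry at position i is (σ_i , z_i).
  Window : Set
  Window = Vec (Fin n × Colour) n

  σ : Window → Fin n → Fin n
  σ w i = proj₁ (lookup w i)

  -- membership in G_{r,n}: σ is a permutation of [n] (injective = bijective on Fin n)
  InG : Window → Set
  InG w = ∀ i j → σ w i ≡ σ w j → i ≡ j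

  -- composition of bijections of Σ: (π ∘ ρ)(i^{[0]}) = π(ρ(i^{[0]}))
  -- π(i^{[c]}) = σ_i^{[z_i + c]}
  _∘w_ : Window → Window → Window
  π ∘w ρ = tabulate λ i → let (s , w) = lookup ρ i
                              (s' , z) = lookup π s
                          in s' , (z ⊕ w)

  idW : Window
  idW = tabulate λ k → k , c0

  -- the element (i^{[t]} j): for i ≠ j the window has j^{[-t]} at position i,
  -- i^{[t]} at position j, k at other positions k; for i = j it has i^{[t]}
  -- at position i and k elsewhere.  (i j) = (i^{[0]} j).
  cyc : Fin n → Fin n → Colour → Window
  cyc i j t = tabulate λ k →
    if ⌊ k Fin.≟ j ⌋ then (i , t)
    else if ⌊ k Fin.≟ i ⌋ then (j , ⊖ t)
    else (k , c0)

  -- The group ring Z[G_{r,n}]: formal Z-linear combinations of group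
  -- elements, represented as lists of (coefficient, element); two such lists
  -- denote the same element iff all coefficients agree (see coeff).
  ZG : Set
  ZG = List (ℤ × Window)

  one : ZG
  one = (1ℤ , idW) ∷ []

  infixr 6 _+ZG_
  infixr 7 _*ZG_

  _+ZG_ : ZG → ZG → ZG
  _+ZG_ = _++_

  _*ZG_ : ZG → ZG → ZG
  x *ZG y = concatMap (λ (a , p) → map (λ (b , q) → (a ℤ.* b , p ∘w q)) y) x

  _≟W_ : (v w : Window) → Dec (v ≡ w)
  _≟W_ = VecP.≡-dec (≡-dec Fin._≟_ Fin._≟_)

  coeff : ZG → Window → ℤ
  coeff [] w = 0ℤ
  coeff ((a , p) ∷ x) w = if ⌊ p ≟W w ⌋ then a ℤ.+ coeff x w else coeff x w

  sumElts : List Window → ZG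
  sumElts = map (λ p → (1ℤ , p))

  -- G_{r,n,f}: σ_i ≤ f_i (paper's 1-based σ_i is toℕ (σ w i) + 1)
  InGf : (Fin n → ℕ) → Window → Set
  InGf f w = InG w × (∀ i → suc (toℕ (σ w i)) ≤ f i)

  -- h : Fin n → Fin n is H(f) (0-based): h_j is the smallest index i such
  -- that some π ∈ G_{r,n,f} has σ_i = j.
  IsH : (Fin n → ℕ) → (Fin n → Fin n) → Set
  IsH f h = ∀ j →
    Σ Window (λ π → InGf f π × σ π (h j) ≡ j)
    × (∀ i (π : Window) → InGf f π → σ π i ≡ j → toℕ (h j) ≤ toℕ i)

  nzColours : List Colour
  nzColours = filter (λ t → 1 ℕ.≤? toℕ t) (allFin r)

  between : ℕ → ℕ → List (Fin n)
  between a b = filter (λ i → a ℕ.≤? toℕ i) (filter (λ i → toℕ i ℕ.≤? b) (allFin n))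

  Ψ : (Fin n → Fin n) → Fin n → ZG
  Ψ h j with toℕ j
  ... | zero = one +ZG sumElts (map (λ t → cyc j j t) nzColours)
  ... | suc j' = one
        +ZG sumElts (map (λ i → cyc i j c0) (between (toℕ (h j)) j'))
        +ZG sumElts (concatMap (λ t → map (λ i → cyc i j t) (between (toℕ (h j)) (suc j'))) nzColours)

  ΨProd : (Fin n → Fin n) → ZG
  ΨProd h = foldr _*ZG_ one (map (Ψ h) (allFin n))

module Submission where

-- Ψ_j is the sum of the elements (i^{[t]} j) over h_j ≤ i ≤ j and all colours t, the term (j^{[0]} j)
-- being 1. Call π a k-prefix if π ∈ G_{r,n,f} and π fixes every position ≥ k together with its colour.
-- By induction on k, Ψ_1 ⋯ Ψ_k is the sum of the k-prefixes, each with coefficient 1. Indeed, if π is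
-- a (k+1)-prefix and σ_i = k (0-based positions), then (i , t) with t read off from the colour of π
-- at i is the only label for which π (i^{[t]} k)⁻¹ fixes position k; minimality of h_k and the fixed
-- positions of π give h_k ≤ i ≤ k, and the quotient is a k-prefix. Conversely a k-prefix times any
-- (i^{[t]} k) with h_k ≤ i ≤ k is a (k+1)-prefix, because f is monotone and k < f_{h_k}. The
-- n-prefixes are exactly the elements of G_{r,n,f}.

open import Defs
open import Data.Nat using (ℕ; NonZero; _≤_)
open import Data.Fin using (Fin) renaming (_≤_ to _≤ᶠ_)
open import Data.Integer using (0ℤ; 1ℤ)
open import Data.Product using (Σ; _×_)
open import Relation.Nullary using (¬_)
open import Relation.Binary.PropositionalEquality using (_≡_)

open import Data.Bool using (if_then_else_)
open import Data.Fin as Fin using (toℕ)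
import Data.Fin.Properties as Fin
open import Data.Integer as ℤ using ()
open import Data.List as List using (List; []; _∷_; _++_; map; concatMap; filter; foldr; allFin)
import Data.List.Properties as List
open import Data.List.Membership.Propositional using (_∈_)
open import Data.List.Membership.Propositional.Properties using (∈-filter⁻; ∈-map⁻; ∈-++⁻; ∈-concatMap⁻)
open import Data.List.Relation.Unary.Any using (here; there; satisfied)
open import Data.Nat using (zero; suc; _+_; _*_; _∸_; _<_; _%_; _≤?_; _<?_; z≤n; s≤s; s≤s⁻¹; >-nonZero⁻¹)
open import Data.Nat.DivMod using (_mod_; m%n<n; %-distribˡ-+; m%n%n≡m%n; m<n⇒m%n≡m; n%n≡0)
import Data.Nat.Properties as ℕ
open import Algebra.Properties.CommutativeSemigroup ℕ.+-commutativeSemigroup using (interchange)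
open import Data.Product using (_,_; proj₁; proj₂; ∃)
open import Data.Product.Properties using (≡-dec)
open import Data.Sum using (inj₁; inj₂)
open import Data.Vec using (lookup; tabulate)
import Data.Vec.Properties as Vec
open import Function using (id; _∘_; flip)
open import Relation.Binary.Definitions using (DecidableEquality)
open import Relation.Binary.PropositionalEquality
  using (refl; sym; trans; cong; cong₂; subst; subst₂; _≢_; module ≡-Reasoning)
open import Relation.Nullary using (Dec; yes; no; contradiction)
open import Relation.Nullary.Decidable using (⌊_⌋)

-- Finite sums and multiplicities

private variable
  A B : Set

𝟙 : ∀ {P : Set} → Dec P → ℕ
𝟙 (yes _) = 1
𝟙 (no _) = 0

𝟙-yes : ∀ {P : Set} (d : Dec P) → P → 𝟙 d ≡ 1
𝟙-yes (yes _) _ = refl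
𝟙-yes (no ¬p) p = contradiction p ¬p

𝟙-no : ∀ {P : Set} (d : Dec P) → ¬ P → 𝟙 d ≡ 0
𝟙-no (yes p) ¬p = contradiction p ¬p
𝟙-no (no _) _ = refl

∑ : List A → (A → ℕ) → ℕ
∑ [] g = 0
∑ (x ∷ xs) g = g x + ∑ xs g

∑-cong : ∀ xs {g g′ : A → ℕ} → (∀ x → x ∈ xs → g x ≡ g′ x) → ∑ xs g ≡ ∑ xs g′
∑-cong [] _ = refl
∑-cong (x ∷ xs) eq = cong₂ _+_ (eq x (here refl)) (∑-cong xs (λ y y∈xs → eq y (there y∈xs)))

∑-zero : ∀ (xs : List A) → ∑ xs (λ _ → 0) ≡ 0
∑-zero [] = refl
∑-zero (_ ∷ xs) = ∑-zero xs

∑-++ : ∀ xs ys (g : A → ℕ) → ∑ (xs ++ ys) g ≡ ∑ xs g + ∑ ys g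
∑-++ [] ys g = refl
∑-++ (x ∷ xs) ys g = trans (cong (g x +_) (∑-++ xs ys g)) (sym (ℕ.+-assoc (g x) _ _))

∑-map : ∀ (φ : A → B) xs (g : B → ℕ) → ∑ (map φ xs) g ≡ ∑ xs (g ∘ φ)
∑-map φ [] g = refl
∑-map φ (x ∷ xs) g = cong (g (φ x) +_) (∑-map φ xs g)

∑-concatMap : ∀ (φ : A → List B) xs (g : B → ℕ) → ∑ (concatMap φ xs) g ≡ ∑ xs (λ x → ∑ (φ x) g)
∑-concatMap φ [] g = refl
∑-concatMap φ (x ∷ xs) g = trans (∑-++ (φ x) (concatMap φ xs) g) (cong (∑ (φ x) g +_) (∑-concatMap φ xs g))

∑-+ : ∀ xs (g g′ : A → ℕ) → ∑ xs g + ∑ xs g′ ≡ ∑ xs (λ x → g x + g′ x)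
∑-+ [] g g′ = refl
∑-+ (x ∷ xs) g g′ = trans (interchange (g x) (∑ xs g) (g′ x) (∑ xs g′)) (cong (g x + g′ x +_) (∑-+ xs g g′))

∑-comm : ∀ xs ys (g : A → B → ℕ) → ∑ xs (λ x → ∑ ys (g x)) ≡ ∑ ys (λ y → ∑ xs (λ x → g x y))
∑-comm [] ys g = sym (∑-zero ys)
∑-comm (x ∷ xs) ys g = trans (cong (∑ ys (g x) +_) (∑-comm xs ys g)) (∑-+ ys (g x) _)

∑-*ˡ : ∀ k xs (g : A → ℕ) → ∑ xs (λ x → k * g x) ≡ k * ∑ xs g
∑-*ˡ k [] g = sym (ℕ.*-zeroʳ k)
∑-*ˡ k (x ∷ xs) g = trans (cong (k * g x +_) (∑-*ˡ k xs g)) (sym (ℕ.*-distribˡ-+ k (g x) _))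

∑-filter : ∀ {P : A → Set} (P? : ∀ x → Dec (P x)) xs (g : A → ℕ) →
  ∑ (filter P? xs) g ≡ ∑ xs (λ x → 𝟙 (P? x) * g x)
∑-filter P? [] g = refl
∑-filter P? (x ∷ xs) g = by-cases (P? x)
  where
    open ≡-Reasoning
    by-cases : Dec _ → ∑ (filter P? (x ∷ xs)) g ≡ 𝟙 (P? x) * g x + ∑ xs (λ x → 𝟙 (P? x) * g x)
    by-cases (yes p) = begin
      ∑ (filter P? (x ∷ xs)) g ≡⟨ cong (λ l → ∑ l g) (List.filter-accept P? p) ⟩
      g x + ∑ (filter P? xs) g ≡⟨ cong₂ _+_ (sym (ℕ.*-identityˡ (g x))) (∑-filter P? xs g) ⟩
      1 * g x + ∑ xs (λ x → 𝟙 (P? x) * g x) ≡⟨ cong (λ k → k * g x + _) (sym (𝟙-yes (P? x) p)) ⟩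
      𝟙 (P? x) * g x + ∑ xs (λ x → 𝟙 (P? x) * g x) ∎
    by-cases (no ¬p) = begin
      ∑ (filter P? (x ∷ xs)) g ≡⟨ cong (λ l → ∑ l g) (List.filter-reject P? ¬p) ⟩
      ∑ (filter P? xs) g ≡⟨ ∑-filter P? xs g ⟩
      0 * g x + ∑ xs (λ x → 𝟙 (P? x) * g x) ≡⟨ cong (λ k → k * g x + _) (sym (𝟙-no (P? x) ¬p)) ⟩
      𝟙 (P? x) * g x + ∑ xs (λ x → 𝟙 (P? x) * g x) ∎

occurrences : DecidableEquality A → A → List A → ℕ
occurrences _≟_ x xs = ∑ xs (λ y → 𝟙 (y ≟ x))

occurrences-map-injective : (_≟_ : DecidableEquality A) (_≟′_ : DecidableEquality B) (φ : A → B) →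
  (∀ {a b} → φ a ≡ φ b → a ≡ b) →
  ∀ {x y} → φ x ≡ y → ∀ xs → occurrences _≟′_ y (map φ xs) ≡ occurrences _≟_ x xs
occurrences-map-injective _≟_ _≟′_ φ φ-inj {x} {y} φx≡y xs = trans (∑-map φ xs _) (∑-cong xs same)
  where
    same : ∀ z → z ∈ xs → 𝟙 (φ z ≟′ y) ≡ 𝟙 (z ≟ x)
    same z _ with z ≟ x
    ... | yes refl = 𝟙-yes (φ z ≟′ y) φx≡y
    ... | no z≢x = 𝟙-no (φ z ≟′ y) (λ φz≡y → z≢x (φ-inj (trans φz≡y (sym φx≡y))))

occurrences-filter : ∀ (_≟_ : DecidableEquality A) {P : A → Set} (P? : ∀ x → Dec (P x)) x xs →
  occurrences _≟_ x (filter P? xs) ≡ 𝟙 (P? x) * occurrences _≟_ x xs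
occurrences-filter _≟_ P? x xs =
  trans (∑-filter P? xs _) (trans (∑-cong xs at-x) (∑-*ˡ (𝟙 (P? x)) xs _))
  where
    at-x : ∀ y → y ∈ xs → 𝟙 (P? y) * 𝟙 (y ≟ x) ≡ 𝟙 (P? x) * 𝟙 (y ≟ x)
    at-x y _ with y ≟ x
    ... | yes refl = refl
    ... | no _ = trans (ℕ.*-zeroʳ (𝟙 (P? y))) (sym (ℕ.*-zeroʳ (𝟙 (P? x))))

occurrences-allFin : ∀ {m} (x : Fin m) → occurrences Fin._≟_ x (allFin m) ≡ 1
occurrences-allFin {suc m} x =
  trans (cong (λ l → 𝟙 (Fin.zero Fin.≟ x) + occurrences Fin._≟_ x l) (sym (List.map-tabulate id Fin.suc)))
        (split x)
  where
    split : ∀ x → 𝟙 (Fin.zero Fin.≟ x) + occurrences Fin._≟_ x (map Fin.suc (allFin m)) ≡ 1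
    split Fin.zero = cong suc (trans (∑-map Fin.suc (allFin m) _) (∑-zero (allFin m)))
    split (Fin.suc x) =
      trans (occurrences-map-injective Fin._≟_ Fin._≟_ Fin.suc Fin.suc-injective refl (allFin m))
            (occurrences-allFin x)

module _ (_≟_ : DecidableEquality A) (_≟′_ : DecidableEquality B) where

  private
    _≟²_ : DecidableEquality (A × B)
    _≟²_ = ≡-dec _≟_ _≟′_

  occurrences-map-,ˡ : ∀ x y ys → occurrences _≟²_ (x , y) (map (x ,_) ys) ≡ occurrences _≟′_ y ys
  occurrences-map-,ˡ x y = occurrences-map-injective _≟′_ _≟²_ (x ,_) (cong proj₂) refl

  occurrences-map-,ʳ : ∀ x y y′ xs →
    occurrences _≟²_ (x , y) (map (_, y′) xs) ≡ occurrences _≟_ x xs * 𝟙 (y′ ≟′ y)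
  occurrences-map-,ʳ x y y′ xs with y′ ≟′ y
  ... | yes refl = trans (occurrences-map-injective _≟_ _≟²_ (_, y) (cong proj₁) refl xs) (sym (ℕ.*-identityʳ _))
  ... | no y′≢y = trans (trans (∑-map (_, y′) xs _) (trans (∑-cong xs absent) (∑-zero xs)))
                        (sym (ℕ.*-zeroʳ (occurrences _≟_ x xs)))
    where
      absent : ∀ z → z ∈ xs → 𝟙 ((z , y′) ≟² (x , y)) ≡ 0
      absent z _ = 𝟙-no ((z , y′) ≟² (x , y)) (y′≢y ∘ cong proj₂)

  occurrences-product : ∀ x y xs ys →
    occurrences _≟²_ (x , y) (concatMap (λ y′ → map (_, y′) xs) ys)
      ≡ occurrences _≟_ x xs * occurrences _≟′_ y ys
  occurrences-product x y xs ys = begin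
    occurrences _≟²_ (x , y) (concatMap (λ y′ → map (_, y′) xs) ys)
      ≡⟨ ∑-concatMap (λ y′ → map (_, y′) xs) ys _ ⟩
    ∑ ys (λ y′ → occurrences _≟²_ (x , y) (map (_, y′) xs))
      ≡⟨ ∑-cong ys (λ y′ _ → occurrences-map-,ʳ x y y′ xs) ⟩
    ∑ ys (λ y′ → occurrences _≟_ x xs * 𝟙 (y′ ≟′ y))
      ≡⟨ ∑-*ˡ (occurrences _≟_ x xs) ys _ ⟩
    occurrences _≟_ x xs * occurrences _≟′_ y ys ∎
    where open ≡-Reasoning

-- A missed value y could be punched out, giving an injection Fin (suc m) → Fin m.
injective⇒surjective : ∀ {m} {g : Fin m → Fin m} → (∀ {a b} → g a ≡ g b → a ≡ b) →
  ∀ y → ∃ λ x → g x ≡ y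
injective⇒surjective {suc m} {g} g-inj y with Fin.any? (λ x → g x Fin.≟ y)
... | yes hit = hit
... | no miss = contradiction (Fin.injective⇒≤ punched-injective) ℕ.1+n≰n
  where
    g≢y : ∀ x → y ≢ g x
    g≢y x y≡gx = miss (x , sym y≡gx)
    punched-injective : ∀ {a b} → Fin.punchOut (g≢y a) ≡ Fin.punchOut (g≢y b) → a ≡ b
    punched-injective eq = g-inj (Fin.punchOut-injective (g≢y _) (g≢y _) eq)

module _ (r n : ℕ) .{{_ : NonZero r}} where
  open Wreath r n

  -- The colour group ℤ/rℤ

  toℕ-mod : ∀ m → toℕ (m mod r) ≡ m % r
  toℕ-mod m = Fin.toℕ-fromℕ< (m%n<n m r)

  toℕ-⊕ : ∀ a b → toℕ (a ⊕ b) ≡ (toℕ a + toℕ b) % r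
  toℕ-⊕ a b = toℕ-mod (toℕ a + toℕ b)

  toℕ-c0 : toℕ c0 ≡ 0
  toℕ-c0 = trans (toℕ-mod 0) (m<n⇒m%n≡m (>-nonZero⁻¹ r))

  %-absorbˡ : ∀ a b → (a % r + b) % r ≡ (a + b) % r
  %-absorbˡ a b = begin
    (a % r + b) % r           ≡⟨ %-distribˡ-+ (a % r) b r ⟩
    (a % r % r + b % r) % r   ≡⟨ cong (λ x → (x + b % r) % r) (m%n%n≡m%n a r) ⟩
    (a % r + b % r) % r       ≡⟨ sym (%-distribˡ-+ a b r) ⟩
    (a + b) % r               ∎
    where open ≡-Reasoning

  ⊕-comm : ∀ a b → a ⊕ b ≡ b ⊕ a
  ⊕-comm a b = Fin.toℕ-injective (begin
    toℕ (a ⊕ b)             ≡⟨ toℕ-⊕ a b ⟩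
    (toℕ a + toℕ b) % r     ≡⟨ cong (_% r) (ℕ.+-comm (toℕ a) (toℕ b)) ⟩
    (toℕ b + toℕ a) % r     ≡⟨ sym (toℕ-⊕ b a) ⟩
    toℕ (b ⊕ a)             ∎)
    where open ≡-Reasoning

  ⊕-assoc : ∀ a b c → (a ⊕ b) ⊕ c ≡ a ⊕ (b ⊕ c)
  ⊕-assoc a b c = Fin.toℕ-injective (begin
    toℕ ((a ⊕ b) ⊕ c)                 ≡⟨ toℕ-⊕ (a ⊕ b) c ⟩
    (toℕ (a ⊕ b) + toℕ c) % r          ≡⟨ cong (λ x → (x + toℕ c) % r) (toℕ-⊕ a b) ⟩
    ((toℕ a + toℕ b) % r + toℕ c) % r  ≡⟨ %-absorbˡ (toℕ a + toℕ b) (toℕ c) ⟩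
    (toℕ a + toℕ b + toℕ c) % r        ≡⟨ cong (_% r) (ℕ.+-assoc (toℕ a) (toℕ b) (toℕ c)) ⟩
    (toℕ a + (toℕ b + toℕ c)) % r      ≡⟨ cong (_% r) (ℕ.+-comm (toℕ a) _) ⟩
    (toℕ b + toℕ c + toℕ a) % r        ≡⟨ sym (%-absorbˡ (toℕ b + toℕ c) (toℕ a)) ⟩
    ((toℕ b + toℕ c) % r + toℕ a) % r  ≡⟨ cong (λ x → (x + toℕ a) % r) (sym (toℕ-⊕ b c)) ⟩
    (toℕ (b ⊕ c) + toℕ a) % r          ≡⟨ sym (toℕ-⊕ (b ⊕ c) a) ⟩
    toℕ ((b ⊕ c) ⊕ a)                 ≡⟨ cong toℕ (⊕-comm (b ⊕ c) a) ⟩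
    toℕ (a ⊕ (b ⊕ c))                 ∎)
    where open ≡-Reasoning

  ⊕-identityˡ : ∀ a → c0 ⊕ a ≡ a
  ⊕-identityˡ a = Fin.toℕ-injective (begin
    toℕ (c0 ⊕ a)            ≡⟨ toℕ-⊕ c0 a ⟩
    (toℕ c0 + toℕ a) % r    ≡⟨ cong (λ x → (x + toℕ a) % r) toℕ-c0 ⟩
    toℕ a % r               ≡⟨ m<n⇒m%n≡m (Fin.toℕ<n a) ⟩
    toℕ a                   ∎)
    where open ≡-Reasoning

  ⊕-identityʳ : ∀ a → a ⊕ c0 ≡ a
  ⊕-identityʳ a = trans (⊕-comm a c0) (⊕-identityˡ a)

  ⊕-inverseʳ : ∀ a → a ⊕ (⊖ a) ≡ c0
  ⊕-inverseʳ a = Fin.toℕ-injective (begin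
    toℕ (a ⊕ (⊖ a))                     ≡⟨ toℕ-⊕ a (⊖ a) ⟩
    (toℕ a + toℕ (⊖ a)) % r             ≡⟨ cong (λ x → (toℕ a + x) % r) (toℕ-mod (r ∸ toℕ a)) ⟩
    (toℕ a + (r ∸ toℕ a) % r) % r       ≡⟨ cong (_% r) (ℕ.+-comm (toℕ a) _) ⟩
    ((r ∸ toℕ a) % r + toℕ a) % r       ≡⟨ %-absorbˡ (r ∸ toℕ a) (toℕ a) ⟩
    (r ∸ toℕ a + toℕ a) % r             ≡⟨ cong (_% r) (ℕ.m∸n+n≡m (ℕ.<⇒≤ (Fin.toℕ<n a))) ⟩
    r % r                               ≡⟨ n%n≡0 r ⟩
    0                                   ≡⟨ sym toℕ-c0 ⟩
    toℕ c0                              ∎)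
    where open ≡-Reasoning

  ⊕-inverseˡ : ∀ a → (⊖ a) ⊕ a ≡ c0
  ⊕-inverseˡ a = trans (⊕-comm (⊖ a) a) (⊕-inverseʳ a)

  ⊖-involutive : ∀ a → ⊖ (⊖ a) ≡ a
  ⊖-involutive a = begin
    ⊖ (⊖ a)                       ≡⟨ sym (⊕-identityʳ _) ⟩
    (⊖ (⊖ a)) ⊕ c0                ≡⟨ cong ((⊖ (⊖ a)) ⊕_) (sym (⊕-inverseˡ a)) ⟩
    (⊖ (⊖ a)) ⊕ ((⊖ a) ⊕ a)       ≡⟨ sym (⊕-assoc _ _ a) ⟩
    ((⊖ (⊖ a)) ⊕ (⊖ a)) ⊕ a       ≡⟨ cong (_⊕ a) (⊕-inverseˡ (⊖ a)) ⟩
    c0 ⊕ a                        ≡⟨ ⊕-identityˡ a ⟩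
    a                             ∎
    where open ≡-Reasoning

  -- Windows under composition

  col : Window → Fin n → Colour
  col w i = proj₂ (lookup w i)

  lookup-∘w : ∀ π ρ x → lookup (π ∘w ρ) x ≡ (σ π (σ ρ x) , col π (σ ρ x) ⊕ col ρ x)
  lookup-∘w π ρ = Vec.lookup∘tabulate _

  lookup-idW : ∀ x → lookup idW x ≡ (x , c0)
  lookup-idW = Vec.lookup∘tabulate _

  σ-idW : ∀ x → σ idW x ≡ x
  σ-idW x = cong proj₁ (lookup-idW x)

  Window-ext : ∀ {v w : Window} → (∀ x → lookup v x ≡ lookup w x) → v ≡ w
  Window-ext {v} {w} eq = begin
    v                    ≡⟨ sym (Vec.tabulate∘lookup v) ⟩
    tabulate (lookup v)  ≡⟨ Vec.tabulate-cong eq ⟩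
    tabulate (lookup w)  ≡⟨ Vec.tabulate∘lookup w ⟩
    w                    ∎
    where open ≡-Reasoning

  ∘w-assoc : ∀ π ρ τ → (π ∘w ρ) ∘w τ ≡ π ∘w (ρ ∘w τ)
  ∘w-assoc π ρ τ = Window-ext at
    where
      at : ∀ x → lookup ((π ∘w ρ) ∘w τ) x ≡ lookup (π ∘w (ρ ∘w τ)) x
      at x rewrite lookup-∘w (π ∘w ρ) τ x | lookup-∘w π ρ (σ τ x)
                 | lookup-∘w π (ρ ∘w τ) x | lookup-∘w ρ τ x
                 = cong (σ π (σ ρ (σ τ x)) ,_) (⊕-assoc _ _ _)

  ∘w-identityˡ : ∀ π → idW ∘w π ≡ π
  ∘w-identityˡ π = Window-ext at
    where
      at : ∀ x → lookup (idW ∘w π) x ≡ lookup π x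
      at x rewrite lookup-∘w idW π x | lookup-idW (σ π x) = cong (σ π x ,_) (⊕-identityˡ (col π x))

  ∘w-identityʳ : ∀ π → π ∘w idW ≡ π
  ∘w-identityʳ π = Window-ext at
    where
      at : ∀ x → lookup (π ∘w idW) x ≡ lookup π x
      at x rewrite lookup-∘w π idW x | lookup-idW x = cong (σ π x ,_) (⊕-identityʳ (col π x))

  σ-∘w : ∀ π ρ x → σ (π ∘w ρ) x ≡ σ π (σ ρ x)
  σ-∘w π ρ x = cong proj₁ (lookup-∘w π ρ x)

  InG-∘w : ∀ π ρ → InG π → InG ρ → InG (π ∘w ρ)
  InG-∘w π ρ π-inj ρ-inj a b eq =
    ρ-inj a b (π-inj _ _ (trans (sym (σ-∘w π ρ a)) (trans eq (σ-∘w π ρ b))))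

  InG-leftInvertible : ∀ q′ q → q′ ∘w q ≡ idW → InG q
  InG-leftInvertible q′ q q′q≡id a b eq = begin
    a                ≡⟨ sym (σ-idW a) ⟩
    σ idW a          ≡⟨ cong (λ w → σ w a) (sym q′q≡id) ⟩
    σ (q′ ∘w q) a    ≡⟨ σ-∘w q′ q a ⟩
    σ q′ (σ q a)     ≡⟨ cong (σ q′) eq ⟩
    σ q′ (σ q b)     ≡⟨ sym (σ-∘w q′ q b) ⟩
    σ (q′ ∘w q) b    ≡⟨ cong (λ w → σ w b) q′q≡id ⟩
    σ idW b          ≡⟨ σ-idW b ⟩
    b                ∎
    where open ≡-Reasoning

  -- The elements (i^{[t]} j)

  cycColour : Fin n → Fin n → Colour → Colour
  cycColour i j t with i Fin.≟ j
  ... | yes _ = t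
  ... | no _ = ⊖ t

  cycColour-involutive : ∀ i j t → cycColour i j (cycColour i j t) ≡ t
  cycColour-involutive i j t with i Fin.≟ j
  ... | yes _ = refl
  ... | no _ = ⊖-involutive t

  cycColour-⊖ : ∀ i j t → cycColour i j (⊖ t) ≡ ⊖ (cycColour i j t)
  cycColour-⊖ i j t with i Fin.≟ j
  ... | yes _ = refl
  ... | no _ = refl

  lookup-cyc : ∀ i j t x → lookup (cyc i j t) x ≡
    (if ⌊ x Fin.≟ j ⌋ then (i , t) else if ⌊ x Fin.≟ i ⌋ then (j , ⊖ t) else (x , c0))
  lookup-cyc i j t = Vec.lookup∘tabulate _

  lookup-cyc-target : ∀ i j t → lookup (cyc i j t) j ≡ (i , t)
  lookup-cyc-target i j t rewrite lookup-cyc i j t j with j Fin.≟ j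
  ... | yes _ = refl
  ... | no j≢j = contradiction refl j≢j

  lookup-cyc-source : ∀ i j t → lookup (cyc i j t) i ≡ (j , cycColour i j t)
  lookup-cyc-source i j t rewrite lookup-cyc i j t i with i Fin.≟ j
  ... | yes refl = refl
  ... | no _ with i Fin.≟ i
  ...   | yes _ = refl
  ...   | no i≢i = contradiction refl i≢i

  lookup-cyc-other : ∀ {i j x} t → x ≢ i → x ≢ j → lookup (cyc i j t) x ≡ (x , c0)
  lookup-cyc-other {i} {j} {x} t x≢i x≢j rewrite lookup-cyc i j t x with x Fin.≟ j
  ... | yes x≡j = contradiction x≡j x≢j
  ... | no _ with x Fin.≟ i
  ...   | yes x≡i = contradiction x≡i x≢i
  ...   | no _ = refl

  lookup-∘w-cyc-target : ∀ ρ i j t → lookup (ρ ∘w cyc i j t) j ≡ (σ ρ i , col ρ i ⊕ t)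
  lookup-∘w-cyc-target ρ i j t rewrite lookup-∘w ρ (cyc i j t) j | lookup-cyc-target i j t = refl

  lookup-∘w-cyc-source : ∀ ρ i j t → lookup (ρ ∘w cyc i j t) i ≡ (σ ρ j , col ρ j ⊕ cycColour i j t)
  lookup-∘w-cyc-source ρ i j t rewrite lookup-∘w ρ (cyc i j t) i | lookup-cyc-source i j t = refl

  lookup-∘w-cyc-other : ∀ ρ {i j x} t → x ≢ i → x ≢ j → lookup (ρ ∘w cyc i j t) x ≡ lookup ρ x
  lookup-∘w-cyc-other ρ {i} {j} {x} t x≢i x≢j
    rewrite lookup-∘w ρ (cyc i j t) x | lookup-cyc-other t x≢i x≢j = cong (σ ρ x ,_) (⊕-identityʳ (col ρ x))

  cyc⁻¹ : Fin n → Fin n → Colour → Window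
  cyc⁻¹ i j t = cyc i j (⊖ cycColour i j t)

  cyc-inverseʳ : ∀ i j t → cyc i j t ∘w cyc⁻¹ i j t ≡ idW
  cyc-inverseʳ i j t = Window-ext at
    where
      at : ∀ x → lookup (cyc i j t ∘w cyc⁻¹ i j t) x ≡ lookup idW x
      at x with x Fin.≟ j
      ... | yes refl rewrite lookup-∘w-cyc-target (cyc i x t) i x (⊖ cycColour i x t)
                           | lookup-cyc-source i x t | lookup-idW x
                           = cong (x ,_) (⊕-inverseʳ (cycColour i x t))
      ... | no x≢j with x Fin.≟ i
      ...   | yes refl rewrite lookup-∘w-cyc-source (cyc x j t) x j (⊖ cycColour x j t)
                             | lookup-cyc-target x j t | lookup-idW x
                             | cycColour-⊖ x j (cycColour x j t) | cycColour-involutive x j t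
                             = cong (x ,_) (⊕-inverseʳ t)
      ...   | no x≢i rewrite lookup-∘w-cyc-other (cyc i j t) (⊖ cycColour i j t) x≢i x≢j
                           | lookup-cyc-other t x≢i x≢j | lookup-idW x = refl

  cyc⁻¹-involutive : ∀ i j t → cyc⁻¹ i j (⊖ cycColour i j t) ≡ cyc i j t
  cyc⁻¹-involutive i j t = cong (cyc i j) (begin
    ⊖ cycColour i j (⊖ cycColour i j t)   ≡⟨ cong ⊖_ (cycColour-⊖ i j (cycColour i j t)) ⟩
    ⊖ (⊖ cycColour i j (cycColour i j t)) ≡⟨ ⊖-involutive _ ⟩
    cycColour i j (cycColour i j t)       ≡⟨ cycColour-involutive i j t ⟩
    t                                     ∎)
    where open ≡-Reasoning

  cyc-inverseˡ : ∀ i j t → cyc⁻¹ i j t ∘w cyc i j t ≡ idW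
  cyc-inverseˡ i j t =
    subst (λ q → cyc⁻¹ i j t ∘w q ≡ idW) (cyc⁻¹-involutive i j t) (cyc-inverseʳ i j (⊖ cycColour i j t))

  cyc-diagonal-c0 : ∀ j → cyc j j c0 ≡ idW
  cyc-diagonal-c0 j = Window-ext at
    where
      at : ∀ x → lookup (cyc j j c0) x ≡ lookup idW x
      at x with x Fin.≟ j
      ... | yes refl = trans (lookup-cyc-target x x c0) (sym (lookup-idW x))
      ... | no x≢j = trans (lookup-cyc-other c0 x≢j x≢j) (sym (lookup-idW x))

  -- Coefficients of products of formal sums

  products : List Window → List Window → List Window
  products A B = concatMap (λ p → map (p ∘w_) B) A

  products-++ˡ : ∀ A B C → products (A ++ B) C ≡ products A C ++ products B C
  products-++ˡ [] B C = refl
  products-++ˡ (p ∷ A) B C =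
    trans (cong (map (p ∘w_) C ++_) (products-++ˡ A B C)) (sym (List.++-assoc (map (p ∘w_) C) _ _))

  map-∘w-products : ∀ p B C → map (p ∘w_) (products B C) ≡ products (map (p ∘w_) B) C
  map-∘w-products p [] C = refl
  map-∘w-products p (q ∷ B) C = begin
    map (p ∘w_) (map (q ∘w_) C ++ products B C)
      ≡⟨ List.map-++ (p ∘w_) (map (q ∘w_) C) _ ⟩
    map (p ∘w_) (map (q ∘w_) C) ++ map (p ∘w_) (products B C)
      ≡⟨ cong₂ _++_ (sym (List.map-∘ C)) (map-∘w-products p B C) ⟩
    map (λ s → p ∘w (q ∘w s)) C ++ products (map (p ∘w_) B) C
      ≡⟨ cong (_++ _) (List.map-cong (λ s → sym (∘w-assoc p q s)) C) ⟩
    map ((p ∘w q) ∘w_) C ++ products (map (p ∘w_) B) C ∎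
    where open ≡-Reasoning

  products-assoc : ∀ A B C → products A (products B C) ≡ products (products A B) C
  products-assoc [] B C = refl
  products-assoc (p ∷ A) B C = begin
    map (p ∘w_) (products B C) ++ products A (products B C)
      ≡⟨ cong₂ _++_ (map-∘w-products p B C) (products-assoc A B C) ⟩
    products (map (p ∘w_) B) C ++ products (products A B) C
      ≡⟨ sym (products-++ˡ (map (p ∘w_) B) (products A B) C) ⟩
    products (map (p ∘w_) B ++ products A B) C ∎
    where open ≡-Reasoning

  products-identityʳ : ∀ A → products A (idW ∷ []) ≡ A
  products-identityʳ [] = refl
  products-identityʳ (p ∷ A) = cong₂ _∷_ (∘w-identityʳ p) (products-identityʳ A)

  products-identityˡ : ∀ A → products (idW ∷ []) A ≡ A
  products-identityˡ A = trans (List.++-identityʳ _) (trans (List.map-cong ∘w-identityˡ A) (List.map-id A))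

  sumElts-*ZG : ∀ A B → sumElts A *ZG sumElts B ≡ sumElts (products A B)
  sumElts-*ZG [] B = refl
  sumElts-*ZG (p ∷ A) B = begin
    map (λ (b , q) → (1ℤ ℤ.* b , p ∘w q)) (sumElts B) ++ sumElts A *ZG sumElts B
      ≡⟨ cong₂ _++_ (trans (sym (List.map-∘ B)) (List.map-∘ B)) (sumElts-*ZG A B) ⟩
    sumElts (map (p ∘w_) B) ++ sumElts (products A B)
      ≡⟨ sym (List.map-++ _ (map (p ∘w_) B) (products A B)) ⟩
    sumElts (map (p ∘w_) B ++ products A B) ∎
    where open ≡-Reasoning

  foldr-*ZG-sumElts : ∀ {I : Set} (F : I → ZG) (G : I → List Window) → (∀ j → F j ≡ sumElts (G j)) →
    ∀ js → foldr _*ZG_ one (map F js) ≡ sumElts (foldr products (idW ∷ []) (map G js))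
  foldr-*ZG-sumElts F G F≡G [] = refl
  foldr-*ZG-sumElts F G F≡G (j ∷ js) =
    trans (cong₂ _*ZG_ (F≡G j) (foldr-*ZG-sumElts F G F≡G js)) (sumElts-*ZG (G j) _)

  coeff-sumElts : ∀ A w → coeff (sumElts A) w ≡ ℤ.+ (occurrences _≟W_ w A)
  coeff-sumElts [] w = refl
  coeff-sumElts (p ∷ A) w with p ≟W w
  ... | yes _ = cong (λ z → 1ℤ ℤ.+ z) (coeff-sumElts A w)
  ... | no _ = coeff-sumElts A w

  occurrences-products : ∀ A C w →
    occurrences _≟W_ w (products A C) ≡ ∑ C (λ q → occurrences _≟W_ w (map (_∘w q) A))
  occurrences-products A C w = begin
    occurrences _≟W_ w (products A C)
      ≡⟨ ∑-concatMap (λ p → map (p ∘w_) C) A _ ⟩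
    ∑ A (λ p → occurrences _≟W_ w (map (p ∘w_) C))
      ≡⟨ ∑-cong A (λ p _ → ∑-map (p ∘w_) C _) ⟩
    ∑ A (λ p → ∑ C (λ q → 𝟙 ((p ∘w q) ≟W w)))
      ≡⟨ ∑-comm A C _ ⟩
    ∑ C (λ q → ∑ A (λ p → 𝟙 ((p ∘w q) ≟W w)))
      ≡⟨ ∑-cong C (λ q _ → sym (∑-map (_∘w q) A _)) ⟩
    ∑ C (λ q → occurrences _≟W_ w (map (_∘w q) A)) ∎
    where open ≡-Reasoning

  ∘w-cancelʳ : ∀ q q′ → q ∘w q′ ≡ idW → ∀ p → (p ∘w q) ∘w q′ ≡ p
  ∘w-cancelʳ q q′ qq′≡id p = trans (∘w-assoc p q q′) (trans (cong (p ∘w_) qq′≡id) (∘w-identityʳ p))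

  occurrences-map-∘wʳ : ∀ q q′ → q ∘w q′ ≡ idW → q′ ∘w q ≡ idW → ∀ π A →
    occurrences _≟W_ π (map (_∘w q) A) ≡ occurrences _≟W_ (π ∘w q′) A
  occurrences-map-∘wʳ q q′ qq′≡id q′q≡id π =
    occurrences-map-injective _≟W_ _≟W_ (_∘w q) ∘w-q-injective (∘w-cancelʳ q′ q q′q≡id π)
    where
      ∘w-q-injective : ∀ {a b} → a ∘w q ≡ b ∘w q → a ≡ b
      ∘w-q-injective {a} {b} eq =
        trans (sym (∘w-cancelʳ q q′ qq′≡id a)) (trans (cong (_∘w q′) eq) (∘w-cancelʳ q q′ qq′≡id b))

  Enumerates : (Window → Set) → List Window → Set
  Enumerates P A = ∀ π → (P π → occurrences _≟W_ π A ≡ 1) × (¬ P π → occurrences _≟W_ π A ≡ 0)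

  -- π occurs in products A (map Q B) once for each l ∈ B and each occurrence of π ∘w Q⁻¹ l in A.
  enumerates-products : ∀ {L : Set} (_≟L_ : DecidableEquality L) (Q Q⁻¹ : L → Window) →
    (∀ l → Q l ∘w Q⁻¹ l ≡ idW) → (∀ l → Q⁻¹ l ∘w Q l ≡ idW) →
    ∀ {P P′} A B → Enumerates P A →
    (∀ π → P′ π → Σ L λ l → occurrences _≟L_ l B ≡ 1 × P (π ∘w Q⁻¹ l)
                            × (∀ l′ → l′ ∈ B → P (π ∘w Q⁻¹ l′) → l′ ≡ l)) →
    (∀ π l → l ∈ B → P (π ∘w Q⁻¹ l) → P′ π) →
    Enumerates P′ (products A (map Q B))
  enumerates-products {L} _≟L_ Q Q⁻¹ QQ⁻¹≡id Q⁻¹Q≡id {P} {P′} A B enum-A unique-factor factor⇒P′ π =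
    (λ P′π → trans count (exactly-one (unique-factor π P′π))) ,
    (λ ¬P′π → trans count
                (trans (∑-cong B (λ l l∈B → proj₂ (enum-A _) (¬P′π ∘ factor⇒P′ π l l∈B))) (∑-zero B)))
    where
      count : occurrences _≟W_ π (products A (map Q B)) ≡ ∑ B (λ l → occurrences _≟W_ (π ∘w Q⁻¹ l) A)
      count = trans (occurrences-products A (map Q B) π)
                (trans (∑-map Q B _)
                  (∑-cong B (λ l _ → occurrences-map-∘wʳ (Q l) (Q⁻¹ l) (QQ⁻¹≡id l) (Q⁻¹Q≡id l) π A)))
      exactly-one : (Σ L λ l → occurrences _≟L_ l B ≡ 1 × P (π ∘w Q⁻¹ l)
                                × (∀ l′ → l′ ∈ B → P (π ∘w Q⁻¹ l′) → l′ ≡ l)) →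
                    ∑ B (λ l → occurrences _≟W_ (π ∘w Q⁻¹ l) A) ≡ 1
      exactly-one (l , once , Pl , unique) = trans (∑-cong B indicator) once
        where
          indicator : ∀ l′ → l′ ∈ B → occurrences _≟W_ (π ∘w Q⁻¹ l′) A ≡ 𝟙 (l′ ≟L l)
          indicator l′ l′∈B with l′ ≟L l
          ... | yes refl = proj₁ (enum-A _) Pl
          ... | no l′≢l = proj₂ (enum-A _) (l′≢l ∘ unique l′ l′∈B)

  between-bounds : ∀ {a b i} → i ∈ between a b → a ≤ toℕ i × toℕ i ≤ b
  between-bounds {a} {b} i∈ =
    let i∈≤b , a≤i = ∈-filter⁻ (λ i → a ≤? toℕ i) {xs = filter (λ i → toℕ i ≤? b) (allFin n)} i∈
    in a≤i , proj₂ (∈-filter⁻ (λ i → toℕ i ≤? b) {xs = allFin n} i∈≤b)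

  occurrences-between : ∀ {a b} i →
    occurrences Fin._≟_ i (between a b) ≡ 𝟙 (a ≤? toℕ i) * (𝟙 (toℕ i ≤? b) * 1)
  occurrences-between {a} {b} i =
    trans (occurrences-filter Fin._≟_ (λ i → a ≤? toℕ i) i (filter (λ i → toℕ i ≤? b) (allFin n)))
      (cong (𝟙 (a ≤? toℕ i) *_) (trans (occurrences-filter Fin._≟_ (λ i → toℕ i ≤? b) i (allFin n))
        (cong (𝟙 (toℕ i ≤? b) *_) (occurrences-allFin i))))

  occurrences-between-inside : ∀ {a b} i → a ≤ toℕ i → toℕ i ≤ b → occurrences Fin._≟_ i (between a b) ≡ 1
  occurrences-between-inside {a} {b} i a≤i i≤b = trans (occurrences-between i)
    (cong₂ (λ x y → x * (y * 1)) (𝟙-yes (a ≤? toℕ i) a≤i) (𝟙-yes (toℕ i ≤? b) i≤b))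

  occurrences-between-above : ∀ {a b} i → b < toℕ i → occurrences Fin._≟_ i (between a b) ≡ 0
  occurrences-between-above {a} {b} i b<i = trans (occurrences-between i)
    (trans (cong (λ y → 𝟙 (a ≤? toℕ i) * (y * 1)) (𝟙-no (toℕ i ≤? b) (ℕ.<⇒≱ b<i)))
           (ℕ.*-zeroʳ (𝟙 (a ≤? toℕ i))))

  occurrences-nzColours : ∀ t → occurrences Fin._≟_ t nzColours ≡ 𝟙 (1 ≤? toℕ t) * 1
  occurrences-nzColours t = trans (occurrences-filter Fin._≟_ (λ t → 1 ≤? toℕ t) t (allFin r))
    (cong (𝟙 (1 ≤? toℕ t) *_) (occurrences-allFin t))

  occurrences-nzColours-≢c0 : ∀ t → t ≢ c0 → occurrences Fin._≟_ t nzColours ≡ 1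
  occurrences-nzColours-≢c0 t t≢c0 = trans (occurrences-nzColours t)
    (cong (_* 1) (𝟙-yes (1 ≤? toℕ t) (ℕ.n≢0⇒n>0 (t≢c0 ∘ Fin.toℕ-injective ∘ flip trans (sym toℕ-c0)))))

  occurrences-nzColours-c0 : occurrences Fin._≟_ c0 nzColours ≡ 0
  occurrences-nzColours-c0 = trans (occurrences-nzColours c0)
    (cong (_* 1) (𝟙-no (1 ≤? toℕ c0) (λ 1≤c0 → ℕ.<-irrefl (sym toℕ-c0) 1≤c0)))

  -- Prefixes of G_{r,n,f}

  FixesFrom : ℕ → Window → Set
  FixesFrom k π = ∀ x → k ≤ toℕ x → lookup π x ≡ (x , c0)

  FixesFrom-below : ∀ {k} π {x} → InG π → FixesFrom k π → toℕ x < k → toℕ (σ π x) < k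
  FixesFrom-below {k} π {x} π-inj fixes x<k with toℕ (σ π x) <? k
  ... | yes σx<k = σx<k
  ... | no σx≮k = contradiction x<k (ℕ.≤⇒≯ (subst (λ y → k ≤ toℕ y) σx≡x k≤σx))
    where
      k≤σx = ℕ.≮⇒≥ σx≮k
      σx≡x : σ π x ≡ x
      σx≡x = π-inj _ _ (cong proj₁ (fixes (σ π x) k≤σx))

  FixesFrom-preimage-below : ∀ {k} π {x} → FixesFrom k π → toℕ (σ π x) < k → toℕ x < k
  FixesFrom-preimage-below {k} π {x} fixes σx<k with toℕ x <? k
  ... | yes x<k = x<k
  ... | no x≮k = subst (λ y → toℕ y < k) (cong proj₁ (fixes x (ℕ.≮⇒≥ x≮k))) σx<k

  -- Some j ≤ x has σ_j ≥ x (pigeonhole on an injective σ), so x < σ_j + 1 ≤ f_j ≤ f_x.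
  nonempty⇒above-diagonal : ∀ (f : Fin n → ℕ) → (∀ a b → toℕ a ≤ toℕ b → f a ≤ f b) →
    Σ Window (InGf f) → ∀ x → suc (toℕ x) ≤ f x
  nonempty⇒above-diagonal f f-mono (π , π-injective , π-bounded) x
    with j , j≤x , x≤σj ← Fin.injective⇒existsPivot {f = σ π} (π-injective _ _) x =
    ℕ.≤-trans (s≤s x≤σj) (ℕ.≤-trans (π-bounded j) (f-mono j x j≤x))

  module _ (f : Fin n → ℕ) (f-mono : ∀ a b → toℕ a ≤ toℕ b → f a ≤ f b)
           (f-above-diagonal : ∀ x → suc (toℕ x) ≤ f x) (h : Fin n → Fin n) (isH : IsH f h) where

    h-witness : ∀ j → suc (toℕ j) ≤ f (h j)
    h-witness j with (π , (_ , π-bounded) , σπhj≡j) , _ ← isH j =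
      subst (λ y → suc (toℕ y) ≤ f (h j)) σπhj≡j (π-bounded (h j))

    h-minimal : ∀ j i π → InGf f π → σ π i ≡ j → toℕ (h j) ≤ toℕ i
    h-minimal j = proj₂ (isH j)

    idW-InGf : InGf f idW
    idW-InGf = (λ a b eq → trans (sym (σ-idW a)) (trans eq (σ-idW b))) ,
               (λ x → subst (λ y → suc (toℕ y) ≤ f x) (sym (σ-idW x)) (f-above-diagonal x))

    h-≤ : ∀ j → toℕ (h j) ≤ toℕ j
    h-≤ j = h-minimal j j idW idW-InGf (σ-idW j)

    InRange : Fin n → Fin n → Set
    InRange j i = toℕ (h j) ≤ toℕ i × toℕ i ≤ toℕ j

    record InPrefix (k : ℕ) (π : Window) : Set where
      field
        inGf : InGf f π
        fixes : FixesFrom k π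
    open InPrefix

    bounded-via : ∀ π {x y} → σ π x ≡ y → suc (toℕ y) ≤ f x → suc (toℕ (σ π x)) ≤ f x
    bounded-via π {x} σπx≡y = subst (λ z → suc (toℕ z) ≤ f x) (sym σπx≡y)

    InPrefix-∘w-cyc : ∀ {ρ i j} t → InRange j i → InPrefix (toℕ j) ρ →
      InPrefix (suc (toℕ j)) (ρ ∘w cyc i j t) × lookup (ρ ∘w cyc i j t) i ≡ (j , cycColour i j t)
    InPrefix-∘w-cyc {ρ} {i} {j} t (hj≤i , i≤j) ρ-prefix =
      record { inGf = π-injective , π-bounded ; fixes = π-fixes } , π-source
      where
        π = ρ ∘w cyc i j t
        ρj : lookup ρ j ≡ (j , c0)
        ρj = fixes ρ-prefix j ℕ.≤-refl
        ρ-bounded = proj₂ (inGf ρ-prefix)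
        π-source : lookup π i ≡ (j , cycColour i j t)
        π-source rewrite lookup-∘w-cyc-source ρ i j t | ρj = cong (j ,_) (⊕-identityˡ _)
        π-injective : InG π
        π-injective = InG-∘w ρ (cyc i j t) (proj₁ (inGf ρ-prefix))
                        (InG-leftInvertible (cyc⁻¹ i j t) (cyc i j t) (cyc-inverseˡ i j t))
        π-bounded : ∀ x → suc (toℕ (σ π x)) ≤ f x
        π-bounded x with x Fin.≟ j | x Fin.≟ i
        ... | yes refl | _ = bounded-via π (cong proj₁ (lookup-∘w-cyc-target ρ i x t))
                               (ℕ.≤-trans (ρ-bounded i) (f-mono i x i≤j))
        ... | no _ | yes refl = bounded-via π (trans (cong proj₁ (lookup-∘w-cyc-source ρ x j t)) (cong proj₁ ρj))
                                  (ℕ.≤-trans (h-witness j) (f-mono (h j) x hj≤i))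
        ... | no x≢j | no x≢i = bounded-via π (cong proj₁ (lookup-∘w-cyc-other ρ t x≢i x≢j)) (ρ-bounded x)
        π-fixes : FixesFrom (suc (toℕ j)) π
        π-fixes x j<x = trans (lookup-∘w-cyc-other ρ t x≢i x≢j) (fixes ρ-prefix x (ℕ.<⇒≤ j<x))
          where
            x≢j : x ≢ j
            x≢j refl = ℕ.<-irrefl refl j<x
            x≢i : x ≢ i
            x≢i refl = ℕ.<-irrefl refl (ℕ.<-≤-trans j<x i≤j)

    InPrefix-unfactor : ∀ π {i j} t → InRange j i → InPrefix (toℕ j) (π ∘w cyc⁻¹ i j t) →
      InPrefix (suc (toℕ j)) π × lookup π i ≡ (j , cycColour i j t)
    InPrefix-unfactor π {i} {j} t i∈range prefix =
      subst (λ w → InPrefix (suc (toℕ j)) w × lookup w i ≡ (j , cycColour i j t))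
            (∘w-cancelʳ (cyc⁻¹ i j t) (cyc i j t) (cyc-inverseˡ i j t) π)
            (InPrefix-∘w-cyc t i∈range prefix)

    InPrefix-factor-unique : ∀ π {i i′ j} t t′ → InRange j i → InRange j i′ →
      InPrefix (toℕ j) (π ∘w cyc⁻¹ i j t) → InPrefix (toℕ j) (π ∘w cyc⁻¹ i′ j t′) →
      (i′ , t′) ≡ (i , t)
    InPrefix-factor-unique π {i} {i′} {j} t t′ i∈range i′∈range prefix prefix′
      with InPrefix-unfactor π t i∈range prefix | InPrefix-unfactor π t′ i′∈range prefix′
    ... | π-prefix , πi | _ , πi′
      with proj₁ (inGf π-prefix) i′ i (trans (cong proj₁ πi′) (sym (cong proj₁ πi)))
    ... | refl = cong (i ,_) (begin
      t′                                 ≡⟨ sym (cycColour-involutive i j t′) ⟩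
      cycColour i j (cycColour i j t′)   ≡⟨ cong (cycColour i j ∘ proj₂) (trans (sym πi′) πi) ⟩
      cycColour i j (cycColour i j t)    ≡⟨ cycColour-involutive i j t ⟩
      t                                  ∎)
      where open ≡-Reasoning

    InPrefix-∘w-cyc-clearing : ∀ {π i j} → InPrefix (suc (toℕ j)) π → σ π i ≡ j → toℕ i ≤ toℕ j →
      InPrefix (toℕ j) (π ∘w cyc i j (⊖ col π i))
    InPrefix-∘w-cyc-clearing {π} {i} {j} π-prefix σπi≡j i≤j =
      record { inGf = ρ-injective , ρ-bounded ; fixes = ρ-fixes }
      where
        c = col π i
        ρ = π ∘w cyc i j (⊖ c)
        π-injective = proj₁ (inGf π-prefix)
        π-bounded = proj₂ (inGf π-prefix)
        ρ-injective : InG ρ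
        ρ-injective = InG-∘w π (cyc i j (⊖ c)) π-injective
                        (InG-leftInvertible (cyc⁻¹ i j (⊖ c)) (cyc i j (⊖ c)) (cyc-inverseˡ i j (⊖ c)))
        ρ-fixes : FixesFrom (toℕ j) ρ
        ρ-fixes x j≤x with x Fin.≟ j
        ... | yes refl = trans (lookup-∘w-cyc-target π i x (⊖ c)) (cong₂ _,_ σπi≡j (⊕-inverseʳ c))
        ... | no x≢j = trans (lookup-∘w-cyc-other π (⊖ c) x≢i x≢j) (fixes π-prefix x j<x)
          where
            j<x : toℕ j < toℕ x
            j<x = ℕ.≤∧≢⇒< j≤x (x≢j ∘ sym ∘ Fin.toℕ-injective)
            x≢i : x ≢ i
            x≢i refl = ℕ.<-irrefl refl (ℕ.≤-<-trans i≤j j<x)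
        ρ-bounded : ∀ x → suc (toℕ (σ ρ x)) ≤ f x
        ρ-bounded x with x Fin.≟ j | x Fin.≟ i
        ... | yes refl | _ = bounded-via ρ (trans (cong proj₁ (lookup-∘w-cyc-target π i x (⊖ c))) σπi≡j)
                               (f-above-diagonal x)
        ... | no _ | yes refl = bounded-via ρ (cong proj₁ (lookup-∘w-cyc-source π x j (⊖ c)))
                                  (ℕ.≤-trans (FixesFrom-below π π-injective (fixes π-prefix) ℕ.≤-refl)
                                             (subst (λ y → suc (toℕ y) ≤ f x) σπi≡j (π-bounded x)))
        ... | no x≢j | no x≢i = bounded-via ρ (cong proj₁ (lookup-∘w-cyc-other π (⊖ c) x≢i x≢j)) (π-bounded x)

    InPrefix-factor : ∀ π j → InPrefix (suc (toℕ j)) π →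
      Σ (Fin n × Colour) λ (i , t) → InRange j i × InPrefix (toℕ j) (π ∘w cyc⁻¹ i j t)
    InPrefix-factor π j π-prefix with injective⇒surjective {g = σ π} (proj₁ (inGf π-prefix) _ _) j
    ... | i , σπi≡j =
      (i , cycColour i j (col π i)) , (h-minimal j i π (inGf π-prefix) σπi≡j , i≤j) ,
      subst (λ q → InPrefix (toℕ j) (π ∘w q)) (sym cyc⁻¹≡) (InPrefix-∘w-cyc-clearing π-prefix σπi≡j i≤j)
      where
        i≤j : toℕ i ≤ toℕ j
        i≤j = s≤s⁻¹ (FixesFrom-preimage-below π (fixes π-prefix)
                      (subst (λ y → toℕ y < suc (toℕ j)) (sym σπi≡j) ℕ.≤-refl))
        cyc⁻¹≡ : cyc⁻¹ i j (cycColour i j (col π i)) ≡ cyc i j (⊖ col π i)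
        cyc⁻¹≡ = cong (λ u → cyc i j (⊖ u)) (cycColour-involutive i j (col π i))

    _≟L_ : DecidableEquality (Fin n × Colour)
    _≟L_ = ≡-dec Fin._≟_ Fin._≟_

    cycTo : Fin n → Fin n × Colour → Window
    cycTo j (i , t) = cyc i j t

    -- The labels (i , t) of the summands (i^{[t]} j) of Ψ_j, listed as in Ψ, with (j^{[0]} j) = 1 first;
    -- the second argument is toℕ j.
    labelsAt : Fin n → ℕ → List (Fin n × Colour)
    labelsAt j zero = (j , c0) ∷ map (j ,_) nzColours
    labelsAt j (suc j′) = (j , c0) ∷ (map (_, c0) (between (toℕ (h j)) j′)
                                     ++ concatMap (λ t → map (_, t) (between (toℕ (h j)) (suc j′))) nzColours)

    labels : Fin n → List (Fin n × Colour)
    labels j = labelsAt j (toℕ j)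

    Ψ-labels : ∀ j → Ψ h j ≡ sumElts (map (cycTo j) (labels j))
    Ψ-labels j with toℕ j
    ... | zero = cong₂ _∷_ (cong (1ℤ ,_) (sym (cyc-diagonal-c0 j))) (cong sumElts (List.map-∘ nzColours))
    ... | suc j′ = cong₂ _∷_ (cong (1ℤ ,_) (sym (cyc-diagonal-c0 j))) (begin
      sumElts (map (λ i → cyc i j c0) strictRange) ++ sumElts (concatMap (λ t → map (λ i → cyc i j t) range) nzColours)
        ≡⟨ sym (List.map-++ _ (map (λ i → cyc i j c0) strictRange) _) ⟩
      sumElts (map (λ i → cyc i j c0) strictRange ++ concatMap (λ t → map (λ i → cyc i j t) range) nzColours)
        ≡⟨ cong sumElts (cong₂ _++_ (List.map-∘ strictRange)
                                    (List.concatMap-cong (λ t → List.map-∘ range) nzColours)) ⟩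
      sumElts (map (cycTo j) (map (_, c0) strictRange) ++ concatMap (λ t → map (cycTo j) (map (_, t) range)) nzColours)
        ≡⟨ cong sumElts (cong (map (cycTo j) (map (_, c0) strictRange) ++_)
                              (sym (List.map-concatMap (cycTo j) (λ t → map (_, t) range) nzColours))) ⟩
      sumElts (map (cycTo j) (map (_, c0) strictRange) ++ map (cycTo j) (concatMap (λ t → map (_, t) range) nzColours))
        ≡⟨ cong sumElts (sym (List.map-++ (cycTo j) (map (_, c0) strictRange) _)) ⟩
      sumElts (map (cycTo j) (map (_, c0) strictRange ++ concatMap (λ t → map (_, t) range) nzColours)) ∎)
      where
        open ≡-Reasoning
        strictRange = between (toℕ (h j)) j′
        range = between (toℕ (h j)) (suc j′)

    labels-InRange : ∀ j {l} → l ∈ labels j → InRange j (proj₁ l)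
    labels-InRange j l∈ with toℕ j in eq
    labels-InRange j (here refl) | zero = h-≤ j , ℕ.≤-reflexive eq
    labels-InRange j (there l∈) | zero with ∈-map⁻ (j ,_) l∈
    ... | _ , _ , refl = h-≤ j , ℕ.≤-reflexive eq
    labels-InRange j (here refl) | suc j′ = h-≤ j , ℕ.≤-reflexive eq
    labels-InRange j (there l∈) | suc j′ with ∈-++⁻ (map (_, c0) (between (toℕ (h j)) j′)) l∈
    ... | inj₁ l∈strict with ∈-map⁻ (_, c0) l∈strict
    ...   | i , i∈ , refl = proj₁ (between-bounds i∈) ,
                            ℕ.m≤n⇒m≤1+n (proj₂ (between-bounds i∈))
    labels-InRange j (there l∈) | suc j′ | inj₂ l∈nz
      with satisfied (∈-concatMap⁻ (λ t → map (_, t) (between (toℕ (h j)) (suc j′))) {xs = nzColours} l∈nz)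
    ... | t , l∈t with ∈-map⁻ (_, t) l∈t
    ...   | i , i∈ , refl = between-bounds i∈

    occurrences-labelsAt-zero : ∀ j t → occurrences _≟L_ (j , t) (labelsAt j zero) ≡ 1
    occurrences-labelsAt-zero j t =
      trans (cong (𝟙 ((j , c0) ≟L (j , t)) +_) (occurrences-map-,ˡ Fin._≟_ Fin._≟_ j t nzColours))
            (by-colour (t Fin.≟ c0))
      where
        by-colour : Dec (t ≡ c0) → 𝟙 ((j , c0) ≟L (j , t)) + occurrences Fin._≟_ t nzColours ≡ 1
        by-colour (yes refl) = cong₂ _+_ (𝟙-yes ((j , c0) ≟L (j , c0)) refl) occurrences-nzColours-c0
        by-colour (no t≢c0) = cong₂ _+_ (𝟙-no ((j , c0) ≟L (j , t)) (t≢c0 ∘ sym ∘ cong proj₂))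
                                        (occurrences-nzColours-≢c0 t t≢c0)

    occurrences-labelsAt-suc : ∀ j {i j′} t → toℕ j ≡ suc j′ → toℕ (h j) ≤ toℕ i → toℕ i ≤ suc j′ →
      occurrences _≟L_ (i , t) (labelsAt j (suc j′)) ≡ 1
    occurrences-labelsAt-suc j {i} {j′} t j≡1+j′ hj≤i i≤1+j′ =
      trans (cong (𝟙 ((j , c0) ≟L (i , t)) +_) split) (by-cases (t Fin.≟ c0) (i Fin.≟ j))
      where
        strictRange = between (toℕ (h j)) j′
        range = between (toℕ (h j)) (suc j′)
        occ-strict = occurrences Fin._≟_ i strictRange
        occ-range = occurrences Fin._≟_ i range
        split : occurrences _≟L_ (i , t) (map (_, c0) strictRange ++ concatMap (λ t′ → map (_, t′) range) nzColours)
                ≡ occ-strict * 𝟙 (c0 Fin.≟ t) + occ-range * occurrences Fin._≟_ t nzColours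
        split = trans (∑-++ (map (_, c0) strictRange) _ _)
                  (cong₂ _+_ (occurrences-map-,ʳ Fin._≟_ Fin._≟_ i t c0 strictRange)
                             (occurrences-product Fin._≟_ Fin._≟_ i t range nzColours))
        by-cases : Dec (t ≡ c0) → Dec (i ≡ j) →
          𝟙 ((j , c0) ≟L (i , t)) + (occ-strict * 𝟙 (c0 Fin.≟ t) + occ-range * occurrences Fin._≟_ t nzColours)
            ≡ 1
        by-cases (yes refl) (yes refl)
          rewrite 𝟙-yes ((i , c0) ≟L (i , c0)) refl | 𝟙-yes (c0 Fin.≟ c0) refl | occurrences-nzColours-c0
                | occurrences-between-above {toℕ (h i)} {j′} i (ℕ.≤-reflexive (sym j≡1+j′))
                | ℕ.*-zeroʳ occ-range = refl
        by-cases (yes refl) (no i≢j)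
          rewrite 𝟙-no ((j , c0) ≟L (i , c0)) (i≢j ∘ sym ∘ cong proj₁) | 𝟙-yes (c0 Fin.≟ c0) refl
                | occurrences-nzColours-c0 | ℕ.*-zeroʳ occ-range
                | occurrences-between-inside {toℕ (h j)} {j′} i hj≤i
                    (s≤s⁻¹ (ℕ.≤∧≢⇒< i≤1+j′ (i≢j ∘ Fin.toℕ-injective ∘ flip trans (sym j≡1+j′)))) = refl
        by-cases (no t≢c0) _
          rewrite 𝟙-no ((j , c0) ≟L (i , t)) (t≢c0 ∘ sym ∘ cong proj₂) | 𝟙-no (c0 Fin.≟ t) (t≢c0 ∘ sym)
                | occurrences-nzColours-≢c0 t t≢c0 | ℕ.*-zeroʳ occ-strict
                | occurrences-between-inside {toℕ (h j)} {suc j′} i hj≤i i≤1+j′ = refl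

    occurrences-labels : ∀ j {i} t → InRange j i → occurrences _≟L_ (i , t) (labels j) ≡ 1
    occurrences-labels j {i} t (hj≤i , i≤j) with toℕ j in eq
    ... | zero rewrite Fin.toℕ-injective {i = i} {j} (trans (ℕ.n≤0⇒n≡0 i≤j) (sym eq)) =
      occurrences-labelsAt-zero j t
    ... | suc j′ = occurrences-labelsAt-suc j t eq hj≤i i≤j

    Ψ-terms : Fin n → List Window
    Ψ-terms j = map (cycTo j) (labels j)

    enumerates-step : ∀ {k} j → toℕ j ≡ k → ∀ A → Enumerates (InPrefix k) A →
      Enumerates (InPrefix (suc k)) (products A (Ψ-terms j))
    enumerates-step j refl A enum-A =
      enumerates-products _≟L_ (cycTo j) (λ (i , t) → cyc⁻¹ i j t)
        (λ (i , t) → cyc-inverseʳ i j t) (λ (i , t) → cyc-inverseˡ i j t) A (labels j) enum-A unique-factor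
        (λ π (i , t) l∈labels → proj₁ ∘ InPrefix-unfactor π t (labels-InRange j l∈labels))
      where
        unique-factor : ∀ π → InPrefix (suc (toℕ j)) π →
          Σ (Fin n × Colour) λ (i , t) →
            occurrences _≟L_ (i , t) (labels j) ≡ 1 × InPrefix (toℕ j) (π ∘w cyc⁻¹ i j t)
            × (∀ l → l ∈ labels j → InPrefix (toℕ j) (π ∘w cyc⁻¹ (proj₁ l) j (proj₂ l)) → l ≡ (i , t))
        unique-factor π π-prefix with InPrefix-factor π j π-prefix
        ... | (i , t) , i∈range , prefix =
          (i , t) , occurrences-labels j t i∈range , prefix ,
          λ (i′ , t′) l∈labels prefix′ →
            InPrefix-factor-unique π t t′ i∈range (labels-InRange j l∈labels) prefix prefix′

    enumerates-prefixes : ∀ {k} m (js : Fin m → Fin n) → (∀ x → toℕ (js x) ≡ k + toℕ x) → k + m ≡ n →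
      ∀ A → Enumerates (InPrefix k) A →
      Enumerates (InPrefix n) (products A (foldr products (idW ∷ []) (map Ψ-terms (List.tabulate js))))
    enumerates-prefixes {k} zero js _ k+0≡n A enum-A =
      subst₂ (λ k B → Enumerates (InPrefix k) B) (trans (sym (ℕ.+-identityʳ k)) k+0≡n)
             (sym (products-identityʳ A)) enum-A
    enumerates-prefixes {k} (suc m) js js-index k+m≡n A enum-A =
      subst (Enumerates (InPrefix n)) (sym (products-assoc A (Ψ-terms (js Fin.zero)) _))
        (enumerates-prefixes m (js ∘ Fin.suc) (λ x → trans (js-index (Fin.suc x)) (ℕ.+-suc k (toℕ x)))
          (trans (sym (ℕ.+-suc k m)) k+m≡n) (products A (Ψ-terms (js Fin.zero)))
          (enumerates-step (js Fin.zero) (trans (js-index Fin.zero) (ℕ.+-identityʳ k)) A enum-A))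

    enumerates-InPrefix-0 : Enumerates (InPrefix 0) (idW ∷ [])
    enumerates-InPrefix-0 π =
      (λ π-prefix → subst (λ w → occurrences _≟W_ w (idW ∷ []) ≡ 1) (identity π-prefix)
                          (cong (_+ 0) (𝟙-yes (idW ≟W idW) refl))) ,
      (λ ¬π-prefix → cong (_+ 0) (𝟙-no (idW ≟W π) (¬π-prefix ∘ flip (subst (InPrefix 0)) idW-prefix)))
      where
        identity : InPrefix 0 π → idW ≡ π
        identity π-prefix = Window-ext (λ x → trans (lookup-idW x) (sym (fixes π-prefix x z≤n)))
        idW-prefix : InPrefix 0 idW
        idW-prefix = record { inGf = idW-InGf ; fixes = λ x _ → lookup-idW x }

    InGf⇒InPrefix-n : ∀ {π} → InGf f π → InPrefix n π
    InGf⇒InPrefix-n π-inGf =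
      record { inGf = π-inGf ; fixes = λ x n≤x → contradiction (Fin.toℕ<n x) (ℕ.≤⇒≯ n≤x) }

    ΨProd-coeff : ∀ π → (InGf f π → coeff (ΨProd h) π ≡ 1ℤ) × (¬ InGf f π → coeff (ΨProd h) π ≡ 0ℤ)
    ΨProd-coeff π =
      (λ π-inGf → trans coeff≡ (cong ℤ.+_ (proj₁ (enumerates-Gf π) (InGf⇒InPrefix-n π-inGf)))) ,
      (λ ¬π-inGf → trans coeff≡ (cong ℤ.+_ (proj₂ (enumerates-Gf π) (¬π-inGf ∘ inGf))))
      where
        L = foldr products (idW ∷ []) (map Ψ-terms (allFin n))
        coeff≡ : coeff (ΨProd h) π ≡ ℤ.+ occurrences _≟W_ π L
        coeff≡ = trans (cong (λ x → coeff x π) (foldr-*ZG-sumElts (Ψ h) Ψ-terms Ψ-labels (allFin n)))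
                       (coeff-sumElts L π)
        enumerates-Gf : Enumerates (InPrefix n) L
        enumerates-Gf = subst (Enumerates (InPrefix n)) (products-identityˡ L)
                          (enumerates-prefixes n id (λ _ → refl) refl (idW ∷ []) enumerates-InPrefix-0)

lemma5p1 : (r n : ℕ) .{{_ : NonZero r}} → 1 ≤ n →
    (f : Fin n → ℕ) →
    (∀ i → 1 ≤ f i) → (∀ i j → i ≤ᶠ j → f i ≤ f j) → (∀ i → f i ≤ n) →
    Σ (Wreath.Window r n) (Wreath.InGf r n f) →
    (h : Fin n → Fin n) → Wreath.IsH r n f h →
    (π : Wreath.Window r n) → Wreath.InG r n π →
      (Wreath.InGf r n f π → Wreath.coeff r n (Wreath.ΨProd r n h) π ≡ 1ℤ)
      × (¬ Wreath.InGf r n f π → Wreath.coeff r n (Wreath.ΨProd r n h) π ≡ 0ℤ)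
-- Only monotonicity and nonemptiness of G_{r,n,f} are needed: they force i < f_i, which makes the
-- bounds 1 ≤ n, 1 ≤ f_i, f_i ≤ n redundant, and the coefficient is computed for every window π.
lemma5p1 r n _ f _ f-mono _ nonempty h isH π _ =
  ΨProd-coeff r n f f-mono (nonempty⇒above-diagonal r n f f-mono nonempty) h isH π
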